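{- Let $k\ge0$ be an integer and define $a_n=n$ for $1\le n\le k+1$ and $a_{n+1}=a_n+a_{n-k}$ for $n\ge k+1$ (the $k$-Skipponacci numbers). Then $\{a_n\}$ has a $(2k+2,k+2)$ far-difference representation: every integer can be written uniquely as a sum of terms $\pm a_n$ in which every two terms of the same sign are at least $2k+2$ apart in index and every two terms of opposite sign are at least $k+2$ apart in index.
   Context: A sum of terms $\pm a_n$ means $\sum_t\epsilon_ta_{n_t}$ with $\epsilon_t\in\{\pm1\}$ and indices $n_t\ge1$; $0$ is the empty sum. -}

module Defs where

open import Data.Nat using (ℕ; zero; suc; _+_; _*_; _∸_; _≤_; _≤ᵇ_; ∣_-_∣)
open import Data.Bool using (if_then_else_)
open import Data.Sign using (Sign) renaming (+ to plus; - to minus)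
open import Data.Integer using (ℤ; _◃_) renaming (_+_ to _+ℤ_; 0ℤ to 0z)
open import Data.Product using (_×_; _,_)
open import Data.List using (List; []; _∷_)
open import Data.List.Relation.Unary.All using (All)
open import Data.List.Relation.Unary.AllPairs using (AllPairs)

-- Auxiliary with fuel (first argument); called with fuel = n it is exact.
skipAux : ℕ → ℕ → ℕ → ℕ
skipAux _ k zero = 0
skipAux zero k (suc n) = 0
skipAux (suc f) k (suc n) =
  if n ≤ᵇ k then suc n else skipAux f k n + skipAux f k (n ∸ k)

-- k-Skipponacci numbers: a_n = n for 1 ≤ n ≤ k+1,
-- a_{n+1} = a_n + a_{n-k} for n ≥ k+1.  (a_0 = 0 is unused.)
skip : ℕ → ℕ → ℕ
skip k n = skipAux n k n

-- A signed term  ε · a_n  is a pair (n , ε).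
Term : Set
Term = ℕ × Sign

value : (ℕ → ℕ) → List Term → ℤ
value a [] = 0z
value a ((n , s) ∷ ts) = (s ◃ a n) +ℤ value a ts

reqGap : ℕ → Sign → Sign → ℕ
reqGap k plus plus = 2 * k + 2
reqGap k minus minus = 2 * k + 2
reqGap k plus minus = k + 2
reqGap k minus plus = k + 2

FarPair : ℕ → Term → Term → Set
FarPair k (i , s) (j , t) = reqGap k s t ≤ ∣ i - j ∣

FarDiff : ℕ → List Term → Set
FarDiff k ts = All (λ t → 1 ≤ Data.Product.proj₁ t) ts × AllPairs (FarPair k) ts

-- Write R n = a n + a (n − (2k+2)) + a (n − 2(2k+2)) + ⋯ for the largest value of a
-- representation with indices ≤ n. Induction on m with the recurrence gives the identity
-- a (m+1) = R m + R (m − (k+1)) + 1, and from it the key estimate: a representation whose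
-- largest index is n has value in (R (n−1), R n] if that term is +a n, and in
-- [−R n, −R (n−1)) if it is −a n. So the leading term is determined by the value, which
-- gives uniqueness once both representations are sorted by index. Conversely the greedy
-- choice of the least n with 0 < v ≤ R n leaves v − a n in [−R (n−k−2), R (n−2k−2)] by the
-- same identity, so recursing on the remainder respects the gap conditions.
module Submission where

open import Defs
open import Data.Bool using (true; false; T)
open import Data.Empty using (⊥-elim)
open import Data.Integer using (ℤ; _⊖_; _◃_; -_; -[1+_]) renaming (_+_ to _+ℤ_; +_ to pos)
import Data.Integer.Properties as ℤ
open import Data.List using (List; []; _∷_; map)
open import Data.List.Relation.Binary.Permutation.Propositional using (_↭_; ↭-sym; ↭-trans; ↭⇒↭ₛ)
import Data.List.Relation.Binary.Permutation.Propositional.Properties as Perm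
import Data.List.Relation.Binary.Permutation.Setoid.Properties as PermSetoid
open import Data.List.Relation.Unary.All as All using (All; []; _∷_)
import Data.List.Relation.Unary.All.Properties as All
open import Data.List.Relation.Unary.AllPairs as AllPairs using (AllPairs; []; _∷_)
import Data.List.Relation.Unary.AllPairs.Properties as AllPairs
open import Data.List.Relation.Unary.Linked as Linked using (Linked; []; [-]; _∷_)
import Data.List.Relation.Unary.Linked.Properties as Linkedₚ
open import Data.Nat
open import Data.Nat.Induction using (<-rec)
open import Data.Nat.ListAction using (sum)
open import Data.Nat.ListAction.Properties using (sum-↭)
open import Data.Nat.Properties
open import Data.Product using (Σ; _×_; _,_; proj₁; proj₂)
open import Data.Sign using (Sign; opposite) renaming (+ to plus; - to minus)
open import Data.Sign.Properties using (opposite-injective)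
open import Data.Sum using (inj₁; inj₂)
open import Data.Unit using (tt)
open import Function using (_∘_)
open import Level using (0ℓ)
open import Relation.Binary.Bundles using (DecTotalOrder)
import Relation.Binary.Construct.Flip.EqAndOrd as Flip
import Relation.Binary.Construct.On as On
open import Relation.Binary.Definitions using (tri<; tri≈; tri>)
open import Relation.Binary.PropositionalEquality
open import Relation.Nullary using (yes; no; ¬_)

open import Algebra.Properties.CommutativeSemigroup +-commutativeSemigroup
  using (interchange; x∙yz≈y∙xz; x∙yz≈xz∙y; xy∙z≈x∙zy; xy∙z≈y∙zx)

+-<-cross : ∀ {p q r p′ q′ r′} → p ≤ q + r → q′ + r′ < p′ → r ≤ r′ → p + q′ < p′ + q
+-<-cross {p} {q} {r} {p′} {q′} {r′} p≤q+r q′+r′<p′ r≤r′ = begin-strict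
  p + q′        ≤⟨ +-monoˡ-≤ q′ (≤-trans p≤q+r (+-monoʳ-≤ q r≤r′)) ⟩
  q + r′ + q′   ≡⟨ xy∙z≈x∙zy q r′ q′ ⟩
  q + (q′ + r′) <⟨ +-monoʳ-< q q′+r′<p′ ⟩
  q + p′        ≡⟨ +-comm q p′ ⟩
  p′ + q        ∎
  where open ≤-Reasoning

m⊖n+[n+o]≡m+o : ∀ m n o → m ⊖ n +ℤ pos (n + o) ≡ pos (m + o)
m⊖n+[n+o]≡m+o m n o = begin
  m ⊖ n +ℤ pos (n + o)      ≡⟨ ℤ.distribˡ-⊖-+-pos (n + o) m n ⟩
  (m + (n + o)) ⊖ n         ≡⟨ cong₂ _⊖_ (x∙yz≈y∙xz m n o) (sym (+-identityʳ n)) ⟩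
  (n + (m + o)) ⊖ (n + 0)   ≡⟨ ℤ.+-cancelˡ-⊖ n (m + o) 0 ⟩
  (m + o) ⊖ 0               ≡⟨ ℤ.⊖-≥ z≤n ⟩
  pos (m + o)               ∎
  where open ≡-Reasoning

⊖≡⊖⇒+≡+ : ∀ {m n o p} → m ⊖ n ≡ o ⊖ p → m + p ≡ o + n
⊖≡⊖⇒+≡+ {m} {n} {o} {p} eq = ℤ.+-injective (begin
  pos (m + p)              ≡⟨ sym (m⊖n+[n+o]≡m+o m n p) ⟩
  m ⊖ n +ℤ pos (n + p)     ≡⟨ cong₂ _+ℤ_ eq (cong pos (+-comm n p)) ⟩
  o ⊖ p +ℤ pos (p + n)     ≡⟨ m⊖n+[n+o]≡m+o o p n ⟩
  pos (o + n)              ∎)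
  where open ≡-Reasoning

+≡+⇒⊖≡⊖ : ∀ {m n o p} → m + p ≡ o + n → m ⊖ n ≡ o ⊖ p
+≡+⇒⊖≡⊖ {m} {n} {o} {p} eq = begin
  m ⊖ n             ≡⟨ sym (ℤ.+-cancelˡ-⊖ p m n) ⟩
  (p + m) ⊖ (p + n) ≡⟨ cong₂ _⊖_ (trans (+-comm p m) eq) (+-comm p n) ⟩
  (o + n) ⊖ (n + p) ≡⟨ cong (_⊖ (n + p)) (+-comm o n) ⟩
  (n + o) ⊖ (n + p) ≡⟨ ℤ.+-cancelˡ-⊖ n o p ⟩
  o ⊖ p             ∎
  where open ≡-Reasoning

⊖-surjective : ∀ z → Σ ℕ λ x → Σ ℕ λ y → x ⊖ y ≡ z
⊖-surjective (pos n)    = n , 0 , ℤ.⊖-≥ z≤n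
⊖-surjective -[1+ n ]   = 0 , suc n , ℤ.⊖-< z<s

negate : Term → Term
negate (n , s) = n , opposite s

Below : Sign → ℕ → List Term → Set
Below s m = All (λ t → proj₂ t ≡ s → proj₁ t ≤ m)

Below-negate : ∀ {s m ts} → Below s m ts → Below (opposite s) m (map negate ts)
Below-negate = All.map⁺ ∘ All.map (λ h eq → h (opposite-injective eq))

All≤⇒Below : ∀ {s m ts} → All (λ t → proj₁ t ≤ m) ts → Below s m ts
All≤⇒Below = All.map (λ t≤m _ → t≤m)

byIndex≥ : DecTotalOrder 0ℓ 0ℓ 0ℓ
byIndex≥ = On.decTotalOrder (Flip.decTotalOrder ≤-decTotalOrder) (proj₁ {B = λ _ → Sign})

open import Data.List.Sort byIndex≥ using (sort; sort-↭; sort-↗)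

_≽_ : Term → Term → Set
t ≽ u = proj₁ u ≤ proj₁ t

Descending : List Term → Set
Descending = Linked _≽_

Descending-negate : ∀ {ts} → Descending ts → Descending (map negate ts)
Descending-negate = Linkedₚ.map⁺

head-dominates : ∀ {t ts} → Descending (t ∷ ts) → All (t ≽_) ts
head-dominates [-]          = []
head-dominates {t} (t≽u ∷ u≽us) =
  Linkedₚ.Linked⇒All (λ t≽u u≽v → ≤-trans u≽v t≽u) {v = t} t≽u u≽us

module SignedSums (a : ℕ → ℕ) where

  contrib : Sign → Term → ℕ
  contrib plus  (n , plus)  = a n
  contrib minus (n , minus) = a n
  contrib _     _           = 0

  part : Sign → List Term → ℕ
  part s ts = sum (map (contrib s) ts)

  part-↭ : ∀ s {ts us} → ts ↭ us → part s ts ≡ part s us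
  part-↭ s p = sum-↭ (Perm.map⁺ (contrib s) p)

  contrib-negate : ∀ s t → contrib s (negate t) ≡ contrib (opposite s) t
  contrib-negate plus  (n , plus)  = refl
  contrib-negate plus  (n , minus) = refl
  contrib-negate minus (n , plus)  = refl
  contrib-negate minus (n , minus) = refl

  part-negate : ∀ s ts → part s (map negate ts) ≡ part (opposite s) ts
  part-negate s []       = refl
  part-negate s (t ∷ ts) = cong₂ _+_ (contrib-negate s t) (part-negate s ts)

  SameValue : List Term → List Term → Set
  SameValue ts us = part plus ts + part minus us ≡ part plus us + part minus ts

  SameValue-↭ : ∀ {ts ts′ us us′} → ts ↭ ts′ → us ↭ us′ →
                SameValue ts us → SameValue ts′ us′
  SameValue-↭ p q eq = trans (cong₂ _+_ (part-↭ plus (↭-sym p)) (part-↭ minus (↭-sym q)))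
                             (trans eq (cong₂ _+_ (part-↭ plus q) (part-↭ minus p)))

  SameValue-tail : ∀ t {ts us} → SameValue (t ∷ ts) (t ∷ us) → SameValue ts us
  SameValue-tail t {ts} {us} eq = +-cancelˡ-≡ (t⁺ + t⁻) _ _ (begin
    (t⁺ + t⁻) + (part plus ts + part minus us) ≡⟨ interchange t⁺ t⁻ _ (part minus us) ⟩
    (t⁺ + part plus ts) + (t⁻ + part minus us) ≡⟨ eq ⟩
    (t⁺ + part plus us) + (t⁻ + part minus ts) ≡⟨ interchange t⁺ _ t⁻ (part minus ts) ⟩
    (t⁺ + t⁻) + (part plus us + part minus ts) ∎)
    where
    open ≡-Reasoning
    t⁺ t⁻ : ℕ
    t⁺ = contrib plus t
    t⁻ = contrib minus t

  value≡part⊖part : ∀ ts → value a ts ≡ part plus ts ⊖ part minus ts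
  value≡part⊖part []               = refl
  value≡part⊖part ((n , plus) ∷ ts) = begin
    (plus ◃ a n) +ℤ value a ts      ≡⟨ cong₂ _+ℤ_ (ℤ.+◃n≡+n (a n)) (value≡part⊖part ts) ⟩
    pos (a n) +ℤ (ts⁺ ⊖ ts⁻)        ≡⟨ ℤ.distribʳ-⊖-+-pos (a n) ts⁺ ts⁻ ⟩
    (a n + ts⁺) ⊖ ts⁻               ∎
    where
    open ≡-Reasoning
    ts⁺ ts⁻ : ℕ
    ts⁺ = part plus ts
    ts⁻ = part minus ts
  value≡part⊖part ((n , minus) ∷ ts) = begin
    (minus ◃ a n) +ℤ value a ts     ≡⟨ cong₂ _+ℤ_ (ℤ.-◃n≡-n (a n)) (value≡part⊖part ts) ⟩
    - pos (a n) +ℤ (ts⁺ ⊖ ts⁻)      ≡⟨ -m+[n⊖o]≡n⊖[m+o] (a n) ts⁺ ts⁻ ⟩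
    ts⁺ ⊖ (a n + ts⁻)               ∎
    where
    open ≡-Reasoning
    ts⁺ ts⁻ : ℕ
    ts⁺ = part plus ts
    ts⁻ = part minus ts
    -m+[n⊖o]≡n⊖[m+o] : ∀ m n o → - pos m +ℤ (n ⊖ o) ≡ n ⊖ (m + o)
    -m+[n⊖o]≡n⊖[m+o] zero    n o = ℤ.+-identityˡ (n ⊖ o)
    -m+[n⊖o]≡n⊖[m+o] (suc m) n o = ℤ.distribʳ-⊖-+-neg m n o

  represents⇒value≡ : ∀ {ts x y} → part plus ts + y ≡ x + part minus ts → value a ts ≡ x ⊖ y
  represents⇒value≡ {ts} {x} {y} eq = trans (value≡part⊖part ts) (+≡+⇒⊖≡⊖ {o = x} {p = y} eq)

  value≡⇒SameValue : ∀ {ts us} → value a ts ≡ value a us → SameValue ts us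
  value≡⇒SameValue {ts} {us} eq =
    ⊖≡⊖⇒+≡+ {part plus ts} {part minus ts} {part plus us} {part minus us}
      (trans (sym (value≡part⊖part ts)) (trans eq (value≡part⊖part us)))

module FarDifferences (k : ℕ) where

  reqGap-sym : ∀ s t → reqGap k s t ≡ reqGap k t s
  reqGap-sym plus  plus  = refl
  reqGap-sym plus  minus = refl
  reqGap-sym minus plus  = refl
  reqGap-sym minus minus = refl

  reqGap-negate : ∀ s t → reqGap k (opposite s) (opposite t) ≡ reqGap k s t
  reqGap-negate plus  plus  = refl
  reqGap-negate plus  minus = refl
  reqGap-negate minus plus  = refl
  reqGap-negate minus minus = refl

  2k+2≡2+[k+k] : 2 * k + 2 ≡ suc (suc (k + k))
  2k+2≡2+[k+k] = trans (+-comm (2 * k) 2) (cong (λ i → 2 + (k + i)) (+-identityʳ k))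

  k+2≤reqGap : ∀ s t → k + 2 ≤ reqGap k s t
  k+2≤reqGap plus  minus = ≤-refl
  k+2≤reqGap minus plus  = ≤-refl
  k+2≤reqGap plus  plus  = subst₂ _≤_ (+-comm 2 k) (sym 2k+2≡2+[k+k]) (s≤s (s≤s (m≤m+n k k)))
  k+2≤reqGap minus minus = subst₂ _≤_ (+-comm 2 k) (sym 2k+2≡2+[k+k]) (s≤s (s≤s (m≤m+n k k)))

  1+n∸reqGap-same : ∀ s n → suc n ∸ reqGap k s s ≡ n ∸ suc (k + k)
  1+n∸reqGap-same plus  n = cong (suc n ∸_) 2k+2≡2+[k+k]
  1+n∸reqGap-same minus n = cong (suc n ∸_) 2k+2≡2+[k+k]

  1+n∸reqGap-opposite : ∀ s n → suc n ∸ reqGap k s (opposite s) ≡ n ∸ suc k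
  1+n∸reqGap-opposite plus  n = cong (suc n ∸_) (+-comm k 2)
  1+n∸reqGap-opposite minus n = cong (suc n ∸_) (+-comm k 2)

  FarPair-sym : ∀ {x y} → FarPair k x y → FarPair k y x
  FarPair-sym {i , s} {j , t} = subst₂ _≤_ (reqGap-sym s t) (∣-∣-comm i j)

  FarPair-negate : ∀ {x y} → FarPair k x y → FarPair k (negate x) (negate y)
  FarPair-negate {i , s} {j , t} = subst (_≤ ∣ i - j ∣) (sym (reqGap-negate s t))

  FarDiff-negate : ∀ {ts} → FarDiff k ts → FarDiff k (map negate ts)
  FarDiff-negate (indices≥1 , far) =
    All.map⁺ indices≥1 , AllPairs.map⁺ (AllPairs.map (λ {x y} → FarPair-negate {x} {y}) far)

  FarDiff-↭ : ∀ {ts us} → ts ↭ us → FarDiff k ts → FarDiff k us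
  FarDiff-↭ p (indices≥1 , far) =
    Perm.All-resp-↭ p indices≥1 ,
    PermSetoid.AllPairs-resp-↭ (setoid Term) (λ {x y} → FarPair-sym {x} {y}) (resp₂ (FarPair k))
      (↭⇒↭ₛ p) far

  FarDiff-tail : ∀ {t ts} → FarDiff k (t ∷ ts) → FarDiff k ts
  FarDiff-tail (_ ∷ indices≥1 , _ ∷ far) = indices≥1 , far

  FarPair⇒≤∸ : ∀ {i s j t} → j ≤ i → FarPair k (i , s) (j , t) → j ≤ i ∸ reqGap k s t
  FarPair⇒≤∸ {i} {s} {j} {t} j≤i gap≤ = m+n≤o⇒m≤o∸n j (begin
    j + reqGap k s t ≤⟨ +-monoʳ-≤ j (subst (reqGap k s t ≤_) (m≤n⇒∣n-m∣≡n∸m j≤i) gap≤) ⟩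
    j + (i ∸ j)      ≡⟨ m+[n∸m]≡n j≤i ⟩
    i                ∎)
    where open ≤-Reasoning

  ≤∸⇒FarPair : ∀ {i s j t} → 1 ≤ j → j ≤ i ∸ reqGap k s t → FarPair k (i , s) (j , t)
  ≤∸⇒FarPair {i} {s} {j} {t} 1≤j j≤i∸g =
    subst (g ≤_) (sym (m≤n⇒∣n-m∣≡n∸m (m+n≤o⇒m≤o j j+g≤i)))
      (m+n≤o⇒m≤o∸n g (subst (_≤ i) (+-comm j g) j+g≤i))
    where
    g : ℕ
    g = reqGap k s t
    g<i : g < i
    g<i = m∸n≢0⇒n<m (λ i∸g≡0 → <-irrefl (sym i∸g≡0) (≤-trans 1≤j j≤i∸g))
    j+g≤i : j + g ≤ i
    j+g≤i = m≤o∸n⇒m+n≤o j (<⇒≤ g<i) j≤i∸g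

  tail-below-gap : ∀ {i s ts} → Descending ((i , s) ∷ ts) → FarDiff k ((i , s) ∷ ts) →
                   All (λ u → proj₁ u ≤ i ∸ reqGap k s (proj₂ u)) ts
  tail-below-gap {s = s} desc (_ , far ∷ _) =
    All.zipWith (λ {u} (j≤i , gap≤) → FarPair⇒≤∸ {s = s} {t = proj₂ u} j≤i gap≤)
      (head-dominates desc , far)

  tail-Below-same : ∀ {n s ts} → Descending ((suc n , s) ∷ ts) → FarDiff k ((suc n , s) ∷ ts) →
                    Below s (n ∸ suc (k + k)) ts
  tail-Below-same {n} {s} desc fd =
    All.map (λ {u} j≤ → λ { refl → subst (proj₁ u ≤_) (1+n∸reqGap-same s n) j≤ })
      (tail-below-gap desc fd)

  tail-below : ∀ {n s ts} → Descending ((suc n , s) ∷ ts) → FarDiff k ((suc n , s) ∷ ts) →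
               All (λ u → proj₁ u ≤ n ∸ suc k) ts
  tail-below {n} {s} desc fd = All.map (λ {u} j≤ → ≤-trans j≤ (gap-cut (proj₂ u))) (tail-below-gap desc fd)
    where
    gap-cut : ∀ t → suc n ∸ reqGap k s t ≤ n ∸ suc k
    gap-cut t = subst (suc n ∸ reqGap k s t ≤_) (cong (suc n ∸_) (+-comm k 2))
                  (∸-monoʳ-≤ (suc n) (k+2≤reqGap s t))

  lead-FarPairs : ∀ {m ts} → All (λ t → 1 ≤ proj₁ t) ts →
                  Below plus (m ∸ suc (k + k)) ts → Below minus (m ∸ suc k) ts →
                  All (FarPair k (suc m , plus)) ts
  lead-FarPairs {ts = []} [] [] [] = []
  lead-FarPairs {m} {(j , plus) ∷ ts} (1≤j ∷ ≥1) (j≤ ∷ b⁺) (_ ∷ b⁻) =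
    ≤∸⇒FarPair {s = plus} {t = plus} 1≤j (subst (j ≤_) (sym (1+n∸reqGap-same plus m)) (j≤ refl))
      ∷ lead-FarPairs ≥1 b⁺ b⁻
  lead-FarPairs {m} {(j , minus) ∷ ts} (1≤j ∷ ≥1) (_ ∷ b⁺) (j≤ ∷ b⁻) =
    ≤∸⇒FarPair {s = plus} {t = minus} 1≤j (subst (j ≤_) (sym (1+n∸reqGap-opposite plus m)) (j≤ refl))
      ∷ lead-FarPairs ≥1 b⁺ b⁻

module Skipponacci (k : ℕ) where

  a : ℕ → ℕ
  a = skip k

  skipAux-fuel-irrelevant : ∀ f g n → n ≤ f → n ≤ g → skipAux f k n ≡ skipAux g k n
  skipAux-fuel-irrelevant f       g       zero    _       _       = refl
  skipAux-fuel-irrelevant (suc f) (suc g) (suc n) (s≤s p) (s≤s q)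
    rewrite skipAux-fuel-irrelevant f g n p q
          | skipAux-fuel-irrelevant f g (n ∸ k) (≤-trans (m∸n≤m n k) p) (≤-trans (m∸n≤m n k) q) = refl

  a-init : ∀ n → n ≤ k → a (suc n) ≡ suc n
  a-init n n≤k with n ≤ᵇ k | ≤⇒≤ᵇ n≤k
  ... | true | _ = refl

  a-rec : ∀ n → k < n → a (suc n) ≡ a n + a (n ∸ k)
  a-rec n k<n with n ≤ᵇ k in eq
  ... | true  = ⊥-elim (<⇒≱ k<n (≤ᵇ⇒≤ n k (subst T (sym eq) tt)))
  ... | false = cong (a n +_) (skipAux-fuel-irrelevant n (n ∸ k) (n ∸ k) (m∸n≤m n k) ≤-refl)

  a-rec-shifted : ∀ p → a (suc (suc k + p)) ≡ a (suc k + p) + a (suc p)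
  a-rec-shifted p = trans (a-rec (suc k + p) (s≤s (m≤m+n k p)))
    (cong (λ i → a (suc k + p) + a i) (trans (cong (_∸ k) (sym (+-suc k p))) (m+n∸m≡n k (suc p))))

  R-fuel : ℕ → ℕ → ℕ
  R-fuel _       zero    = 0
  R-fuel zero    (suc n) = 0
  R-fuel (suc f) (suc n) = a (suc n) + R-fuel f (n ∸ suc (k + k))

  R-fuel-irrelevant : ∀ f g n → n ≤ f → n ≤ g → R-fuel f n ≡ R-fuel g n
  R-fuel-irrelevant f       g       zero    _       _       = refl
  R-fuel-irrelevant (suc f) (suc g) (suc n) (s≤s p) (s≤s q) =
    cong (a (suc n) +_) (R-fuel-irrelevant f g _ (≤-trans n∸[1+k+k]≤n p) (≤-trans n∸[1+k+k]≤n q))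
    where
    n∸[1+k+k]≤n : n ∸ suc (k + k) ≤ n
    n∸[1+k+k]≤n = m∸n≤m n (suc (k + k))

  R : ℕ → ℕ
  R n = R-fuel n n

  R-suc : ∀ n → R (suc n) ≡ a (suc n) + R (n ∸ suc (k + k))
  R-suc n = cong (a (suc n) +_) (R-fuel-irrelevant n _ _ (m∸n≤m n (suc (k + k))) ≤-refl)

  R-init : ∀ m → m ≤ k → R m ≡ m
  R-init zero    _   = refl
  R-init (suc n) n<k = begin
    R (suc n)                       ≡⟨ R-suc n ⟩
    a (suc n) + R (n ∸ suc (k + k)) ≡⟨ cong₂ (λ i j → i + R j) (a-init n (<⇒≤ n<k)) n∸[1+k+k]≡0 ⟩
    suc n + 0                       ≡⟨ +-identityʳ (suc n) ⟩
    suc n                           ∎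
    where
    open ≡-Reasoning
    n∸[1+k+k]≡0 : n ∸ suc (k + k) ≡ 0
    n∸[1+k+k]≡0 = m≤n⇒m∸n≡0 (≤-trans (<⇒≤ n<k) (≤-trans (m≤m+n k k) (n≤1+n _)))

  R-shift : ∀ p → R (suc k + p) ≡ a (suc k + p) + R (p ∸ suc k)
  R-shift p = trans (R-suc (k + p))
    (cong (λ i → a (suc k + p) + R i)
      (trans (cong (k + p ∸_) (sym (+-suc k k))) ([m+n]∸[m+o]≡n∸o k p (suc k))))

  a[1+m]≡1+R[m]+R[m∸1+k] : ∀ m → a (suc m) ≡ suc (R m + R (m ∸ suc k))
  a[1+m]≡1+R[m]+R[m∸1+k] = <-rec _ step
    where
    open ≡-Reasoning
    step : ∀ m → (∀ {p} → p < m → a (suc p) ≡ suc (R p + R (p ∸ suc k))) →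
           a (suc m) ≡ suc (R m + R (m ∸ suc k))
    step m ih with m ≤? k
    ... | yes m≤k = begin
      a (suc m)                   ≡⟨ a-init m m≤k ⟩
      suc m                       ≡⟨ cong suc (sym (R-init m m≤k)) ⟩
      suc (R m)                   ≡⟨ cong suc (sym (+-identityʳ (R m))) ⟩
      suc (R m + R 0)             ≡⟨ cong (λ i → suc (R m + R i)) (sym (m≤n⇒m∸n≡0 (m≤n⇒m≤1+n m≤k))) ⟩
      suc (R m + R (m ∸ suc k))   ∎
    ... | no m≰k with m≤n⇒∃[o]m+o≡n (≰⇒> m≰k)
    ...   | p , refl = begin
      a (suc (suc k + p))                          ≡⟨ a-rec-shifted p ⟩
      a (suc k + p) + a (suc p)                    ≡⟨ cong (a (suc k + p) +_) (ih (s≤s (m≤n+m p k))) ⟩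
      a (suc k + p) + suc (R p + R (p ∸ suc k))    ≡⟨ +-suc (a (suc k + p)) _ ⟩
      suc (a (suc k + p) + (R p + R (p ∸ suc k)))  ≡⟨ cong suc (x∙yz≈xz∙y (a (suc k + p)) (R p) _) ⟩
      suc (a (suc k + p) + R (p ∸ suc k) + R p)    ≡⟨ cong₂ (λ i j → suc (i + R j)) (sym (R-shift p))
                                                                                   (sym (m+n∸m≡n (suc k) p)) ⟩
      suc (R (suc k + p) + R (suc k + p ∸ suc k))  ∎

  R<a : ∀ n → R n < a (suc n)
  R<a n = ≤-trans (s≤s (m≤m+n (R n) _)) (≤-reflexive (sym (a[1+m]≡1+R[m]+R[m∸1+k] n)))

  R[n∸1+k]<a : ∀ n → R (n ∸ suc k) < a (suc n)
  R[n∸1+k]<a n = ≤-trans (s≤s (m≤n+m _ (R n))) (≤-reflexive (sym (a[1+m]≡1+R[m]+R[m∸1+k] n)))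

  R-<-suc : ∀ n → R n < R (suc n)
  R-<-suc n = ≤-trans (R<a n) (≤-trans (m≤m+n _ _) (≤-reflexive (sym (R-suc n))))

  R-mono-≤ : ∀ {m n} → m ≤ n → R m ≤ R n
  R-mono-≤ {n = zero}  z≤n = ≤-refl
  R-mono-≤ {m} {suc n} m≤1+n with m≤n⇒m<n∨m≡n m≤1+n
  ... | inj₁ (s≤s m≤n) = ≤-trans (R-mono-≤ m≤n) (<⇒≤ (R-<-suc n))
  ... | inj₂ refl      = ≤-refl

  n≤R[n] : ∀ n → n ≤ R n
  n≤R[n] zero    = z≤n
  n≤R[n] (suc n) = ≤-trans (s≤s (n≤R[n] n)) (R-<-suc n)

  open SignedSums a
  open FarDifferences k

  -- Bounds and uniqueness

  part⁺≤part⁻+R : ∀ {ts m} → Descending ts → FarDiff k ts → Below plus m ts →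
                  part plus ts ≤ part minus ts + R m
  part⁺≤part⁻+R {[]} _ _ _ = z≤n
  part⁺≤part⁻+R {(zero , _) ∷ _} _ (() ∷ _ , _) _
  part⁺≤part⁻+R {(suc n , plus) ∷ ts} {m} desc fd (1+n≤m ∷ _) = begin
    a (suc n) + part plus ts                          ≤⟨ +-monoʳ-≤ (a (suc n)) tail-bound ⟩
    a (suc n) + (part minus ts + R (n ∸ suc (k + k))) ≡⟨ x∙yz≈y∙xz (a (suc n)) (part minus ts) _ ⟩
    part minus ts + (a (suc n) + R (n ∸ suc (k + k))) ≡⟨ cong (part minus ts +_) (sym (R-suc n)) ⟩
    part minus ts + R (suc n)                         ≤⟨ +-monoʳ-≤ _ (R-mono-≤ (1+n≤m refl)) ⟩
    part minus ts + R m                               ∎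
    where
    open ≤-Reasoning
    tail-bound : part plus ts ≤ part minus ts + R (n ∸ suc (k + k))
    tail-bound = part⁺≤part⁻+R (Linked.tail desc) (FarDiff-tail fd) (tail-Below-same desc fd)
  part⁺≤part⁻+R {(suc n , minus) ∷ ts} {m} desc fd (_ ∷ _) = begin
    part plus ts                  ≤⟨ tail-bound ⟩
    part minus ts + R (n ∸ suc k) ≤⟨ +-monoʳ-≤ (part minus ts) (<⇒≤ (R[n∸1+k]<a n)) ⟩
    part minus ts + a (suc n)     ≡⟨ +-comm (part minus ts) (a (suc n)) ⟩
    a (suc n) + part minus ts     ≤⟨ m≤m+n _ (R m) ⟩
    a (suc n) + part minus ts + R m ∎
    where
    open ≤-Reasoning
    tail-bound : part plus ts ≤ part minus ts + R (n ∸ suc k)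
    tail-bound = part⁺≤part⁻+R (Linked.tail desc) (FarDiff-tail fd) (All≤⇒Below (tail-below desc fd))

  part⁻≤part⁺+R : ∀ {ts m} → Descending ts → FarDiff k ts → Below minus m ts →
                  part minus ts ≤ part plus ts + R m
  part⁻≤part⁺+R {ts} {m} desc fd below =
    subst₂ (λ p q → p ≤ q + R m) (part-negate plus ts) (part-negate minus ts)
      (part⁺≤part⁻+R (Descending-negate desc) (FarDiff-negate fd) (Below-negate below))

  lead-interval : ∀ s {n ts} → Descending ((suc n , s) ∷ ts) → FarDiff k ((suc n , s) ∷ ts) →
    part (opposite s) ((suc n , s) ∷ ts) + R n < part s ((suc n , s) ∷ ts) ×
    part s ((suc n , s) ∷ ts) ≤ part (opposite s) ((suc n , s) ∷ ts) + R (suc n)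
  lead-interval plus {n} {ts} desc fd = lower , upper
    where
    open ≤-Reasoning
    tail-bound : part minus ts ≤ part plus ts + R (n ∸ suc k)
    tail-bound = part⁻≤part⁺+R (Linked.tail desc) (FarDiff-tail fd) (All≤⇒Below (tail-below desc fd))
    lower : part minus ts + R n < a (suc n) + part plus ts
    lower = begin-strict
      part minus ts + R n                       ≤⟨ +-monoˡ-≤ (R n) tail-bound ⟩
      part plus ts + R (n ∸ suc k) + R n        ≡⟨ xy∙z≈x∙zy (part plus ts) _ (R n) ⟩
      part plus ts + (R n + R (n ∸ suc k))      <⟨ +-monoʳ-< (part plus ts) ≤-refl ⟩
      part plus ts + suc (R n + R (n ∸ suc k))  ≡⟨ cong (part plus ts +_) (sym (a[1+m]≡1+R[m]+R[m∸1+k] n)) ⟩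
      part plus ts + a (suc n)                  ≡⟨ +-comm (part plus ts) (a (suc n)) ⟩
      a (suc n) + part plus ts                  ∎
    upper : a (suc n) + part plus ts ≤ part minus ts + R (suc n)
    upper = part⁺≤part⁻+R desc fd ((λ _ → ≤-refl) ∷ All≤⇒Below (head-dominates desc))
  lead-interval minus {n} {ts} desc fd =
    subst₂ (λ p q → p + R n < q × q ≤ p + R (suc n)) (part-negate minus xs) (part-negate plus xs)
      (lead-interval plus (Descending-negate desc) (FarDiff-negate fd))
    where
    xs : List Term
    xs = (suc n , minus) ∷ ts

  lead-dominates : ∀ s {n ts} → Descending ((suc n , s) ∷ ts) → FarDiff k ((suc n , s) ∷ ts) →
                   part (opposite s) ((suc n , s) ∷ ts) < part s ((suc n , s) ∷ ts)
  lead-dominates s desc fd = ≤-<-trans (m≤m+n _ _) (proj₁ (lead-interval s desc fd))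

  nonempty-nonzero : ∀ {t ts} → Descending (t ∷ ts) → FarDiff k (t ∷ ts) →
                     part plus (t ∷ ts) ≢ part minus (t ∷ ts)
  nonempty-nonzero {zero , _} _ (() ∷ _ , _) _
  nonempty-nonzero {suc _ , plus}  desc fd eq = <-irrefl (sym eq) (lead-dominates plus desc fd)
  nonempty-nonzero {suc _ , minus} desc fd eq = <-irrefl eq (lead-dominates minus desc fd)

  SameValue-sign : ∀ s {ts us} → SameValue ts us →
                   part s ts + part (opposite s) us ≡ part s us + part (opposite s) ts
  SameValue-sign plus  eq = eq
  SameValue-sign minus {ts} {us} eq =
    trans (+-comm (part minus ts) (part plus us)) (trans (sym eq) (+-comm (part plus ts) (part minus us)))

  same-sign-leads : ∀ s {i j ts us} →
    Descending ((suc i , s) ∷ ts) → Descending ((suc j , s) ∷ us) →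
    FarDiff k ((suc i , s) ∷ ts) → FarDiff k ((suc j , s) ∷ us) →
    SameValue ((suc i , s) ∷ ts) ((suc j , s) ∷ us) → i ≡ j
  same-sign-leads s {i} {j} {ts} {us} dt du ft fu eq
    with lead-interval s dt ft | lead-interval s du fu | SameValue-sign s {(suc i , s) ∷ ts} {(suc j , s) ∷ us} eq
  ... | lowerT , upperT | lowerU , upperU | eq′ with <-cmp i j
  ...   | tri< i<j _ _ = ⊥-elim (<-irrefl eq′ (+-<-cross upperT lowerU (R-mono-≤ i<j)))
  ...   | tri> _ _ j<i = ⊥-elim (<-irrefl (sym eq′) (+-<-cross upperU lowerT (R-mono-≤ j<i)))
  ...   | tri≈ _ i≡j _ = i≡j

  opposite-sign-leads : ∀ {i j ts us} →
    Descending ((suc i , plus) ∷ ts) → Descending ((suc j , minus) ∷ us) →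
    FarDiff k ((suc i , plus) ∷ ts) → FarDiff k ((suc j , minus) ∷ us) →
    ¬ SameValue ((suc i , plus) ∷ ts) ((suc j , minus) ∷ us)
  opposite-sign-leads {i} {j} {ts} {us} dt du ft fu eq =
    <-irrefl (trans (+-comm (part minus xs) (part plus ys)) (sym eq))
      (+-mono-< (lead-dominates plus dt ft) (lead-dominates minus du fu))
    where
    xs ys : List Term
    xs = (suc i , plus) ∷ ts
    ys = (suc j , minus) ∷ us

  same-lead : ∀ {t u ts us} → Descending (t ∷ ts) → Descending (u ∷ us) →
              FarDiff k (t ∷ ts) → FarDiff k (u ∷ us) → SameValue (t ∷ ts) (u ∷ us) → t ≡ u
  same-lead {zero , _} _ _ (() ∷ _ , _) _ _
  same-lead {_} {zero , _} _ _ _ (() ∷ _ , _) _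
  same-lead {suc i , plus}  {suc j , plus}  dt du ft fu eq =
    cong (λ n → suc n , plus) (same-sign-leads plus dt du ft fu eq)
  same-lead {suc i , minus} {suc j , minus} dt du ft fu eq =
    cong (λ n → suc n , minus) (same-sign-leads minus dt du ft fu eq)
  same-lead {suc i , plus}  {suc j , minus} dt du ft fu eq = ⊥-elim (opposite-sign-leads dt du ft fu eq)
  same-lead {suc i , minus} {suc j , plus}  dt du ft fu eq = ⊥-elim (opposite-sign-leads du dt fu ft (sym eq))

  descending-unique : ∀ {ts us} → Descending ts → Descending us → FarDiff k ts → FarDiff k us →
                      SameValue ts us → ts ≡ us
  descending-unique {[]}    {[]}    _  _  _  _  _  = refl
  descending-unique {[]} {us@(_ ∷ _)} _ du _ fu eq =
    ⊥-elim (nonempty-nonzero du fu (sym (trans eq (+-identityʳ (part plus us)))))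
  descending-unique {ts@(_ ∷ _)} {[]} dt _ ft _ eq =
    ⊥-elim (nonempty-nonzero dt ft (trans (sym (+-identityʳ (part plus ts))) eq))
  descending-unique {t ∷ ts} {_ ∷ us} dt du ft fu eq with same-lead dt du ft fu eq
  ... | refl = cong (t ∷_) (descending-unique (Linked.tail dt) (Linked.tail du) (FarDiff-tail ft) (FarDiff-tail fu)
                              (SameValue-tail t {ts} {us} eq))

  -- Existence by the greedy algorithm

  -- A representation of x − y, with the subtraction kept out of ℕ.
  record Representation (p q x y : ℕ) : Set where
    field
      terms       : List Term
      far-diff    : FarDiff k terms
      represents  : part plus terms + y ≡ x + part minus terms
      plus-below  : Below plus p terms
      minus-below : Below minus q terms

  Representation-negate : ∀ {p q x y} → Representation p q x y → Representation q p y x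
  Representation-negate {p} {q} {x} {y} r = record
    { terms       = map negate terms
    ; far-diff    = FarDiff-negate far-diff
    ; represents  = begin
        part plus (map negate terms) + x ≡⟨ cong (_+ x) (part-negate plus terms) ⟩
        part minus terms + x             ≡⟨ +-comm (part minus terms) x ⟩
        x + part minus terms             ≡⟨ sym represents ⟩
        part plus terms + y              ≡⟨ +-comm (part plus terms) y ⟩
        y + part plus terms              ≡⟨ cong (y +_) (sym (part-negate minus terms)) ⟩
        y + part minus (map negate terms) ∎
    ; plus-below  = Below-negate minus-below
    ; minus-below = Below-negate plus-below
    }
    where
    open Representation r
    open ≡-Reasoning

  prepend-lead : ∀ {m p q x y} → suc m ≤ p → m ∸ suc k ≤ q →
                 Representation (m ∸ suc (k + k)) (m ∸ suc k) x (y + a (suc m)) →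
                 Representation p q x y
  prepend-lead {m} {p} {q} {x} {y} 1+m≤p m∸1+k≤q r = record
    { terms       = (suc m , plus) ∷ terms
    ; far-diff    = s≤s z≤n ∷ proj₁ far-diff
                  , lead-FarPairs (proj₁ far-diff) plus-below minus-below ∷ proj₂ far-diff
    ; represents  = trans (xy∙z≈y∙zx (a (suc m)) (part plus terms) y) represents
    ; plus-below  = (λ _ → 1+m≤p) ∷ All.map (λ j≤ e → ≤-trans (j≤ e) m∸1+2k≤p) plus-below
    ; minus-below = (λ ()) ∷ All.map (λ j≤ e → ≤-trans (j≤ e) m∸1+k≤q) minus-below
    }
    where
    open Representation r
    m∸1+2k≤p : m ∸ suc (k + k) ≤ p
    m∸1+2k≤p = ≤-trans (m∸n≤m m (suc (k + k))) (≤-trans (n≤1+n m) 1+m≤p)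

  threshold : ∀ p {x y} → y < x → x ≤ y + R p →
              Σ ℕ λ m → suc m ≤ p × y + R m < x × x ≤ y + R (suc m)
  threshold zero    {x} {y} y<x x≤y+R₀ = ⊥-elim (<⇒≱ y<x (subst (x ≤_) (+-identityʳ y) x≤y+R₀))
  threshold (suc p) {x} {y} y<x x≤y+R with x ≤? y + R p
  ... | no  x≰y+R = p , ≤-refl , ≰⇒> x≰y+R , x≤y+R
  ... | yes x≤y+R′ with threshold p y<x x≤y+R′
  ...   | m , 1+m≤p , below , above = m , m≤n⇒m≤1+n 1+m≤p , below , above

  -- The index bounds of a representation are kept within k + 2 of each other, so that
  -- the bound on the opposite sign survives the greedy step.
  RepresentableUpTo : ℕ → Set
  RepresentableUpTo f = ∀ {p q} → p ≤ f → q ≤ f → p ∸ suc (suc k) ≤ q → q ∸ suc (suc k) ≤ p →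
                        ∀ {x y} → x ≤ y + R p → y ≤ x + R q → Representation p q x y

  greedy-step : ∀ {f} → RepresentableUpTo f → ∀ {p q} → p ≤ suc f → p ∸ suc (suc k) ≤ q →
                ∀ {x y} → y < x → x ≤ y + R p → Representation p q x y
  greedy-step {f} representable {p} {q} p≤1+f p-window {x} {y} y<x x≤y+R with threshold p y<x x≤y+R
  ... | m , 1+m≤p , y+Rm<x , x≤y+R[1+m] =
    prepend-lead 1+m≤p m∸1+k≤q
      (representable (≤-trans (m∸n≤m m (suc (k + k))) m≤f) (≤-trans (m∸n≤m m (suc k)) m≤f)
                     window₁ window₂ remainder≤ remainder≥)
    where
    open ≤-Reasoning
    m≤f : m ≤ f
    m≤f = ≤-pred (≤-trans 1+m≤p p≤1+f)
    m∸1+k≤q : m ∸ suc k ≤ q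
    m∸1+k≤q = ≤-trans (∸-monoˡ-≤ (suc (suc k)) 1+m≤p) p-window
    window₁ : m ∸ suc (k + k) ∸ suc (suc k) ≤ m ∸ suc k
    window₁ = ≤-trans (m∸n≤m _ (suc (suc k))) (∸-monoʳ-≤ m (s≤s (m≤m+n k k)))
    window₂ : m ∸ suc k ∸ suc (suc k) ≤ m ∸ suc (k + k)
    window₂ = subst (_≤ m ∸ suc (k + k)) (sym (∸-+-assoc m (suc k) (suc (suc k))))
                (∸-monoʳ-≤ m (s≤s (+-monoʳ-≤ k (m≤n⇒m≤1+n (n≤1+n k)))))
    remainder≤ : x ≤ y + a (suc m) + R (m ∸ suc (k + k))
    remainder≤ = begin
      x                                   ≤⟨ x≤y+R[1+m] ⟩
      y + R (suc m)                       ≡⟨ cong (y +_) (R-suc m) ⟩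
      y + (a (suc m) + R (m ∸ suc (k + k))) ≡⟨ sym (+-assoc y _ _) ⟩
      y + a (suc m) + R (m ∸ suc (k + k)) ∎
    remainder≥ : y + a (suc m) ≤ x + R (m ∸ suc k)
    remainder≥ = begin
      y + a (suc m)                        ≡⟨ cong (y +_) (a[1+m]≡1+R[m]+R[m∸1+k] m) ⟩
      y + suc (R m + R (m ∸ suc k))        ≡⟨ +-suc y _ ⟩
      suc (y + (R m + R (m ∸ suc k)))      ≡⟨ cong suc (sym (+-assoc y (R m) _)) ⟩
      suc (y + R m) + R (m ∸ suc k)        ≤⟨ +-monoˡ-≤ (R (m ∸ suc k)) y+Rm<x ⟩
      x + R (m ∸ suc k)                    ∎

  representable : ∀ f → RepresentableUpTo f
  representable f p≤f q≤f p-window q-window {x} {y} x≤y+R y≤x+R with <-cmp x y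
  ... | tri≈ _ refl _ = record
    { terms = [] ; far-diff = [] , [] ; represents = sym (+-identityʳ x) ; plus-below = [] ; minus-below = [] }
  representable zero    z≤n _ _ _ {x} {y} x≤y+R _ | tri> _ _ y<x =
    ⊥-elim (<⇒≱ y<x (subst (x ≤_) (+-identityʳ y) x≤y+R))
  representable (suc f) p≤f _ p-window _ x≤y+R _ | tri> _ _ y<x =
    greedy-step (representable f) p≤f p-window y<x x≤y+R
  representable zero    _ z≤n _ _ {x} {y} _ y≤x+R | tri< x<y _ _ =
    ⊥-elim (<⇒≱ x<y (subst (y ≤_) (+-identityʳ x) y≤x+R))
  representable (suc f) _ q≤f _ q-window _ y≤x+R | tri< x<y _ _ =
    Representation-negate (greedy-step (representable f) q≤f q-window x<y y≤x+R)

  far-difference-exists : ∀ x y → Σ (List Term) λ ts → FarDiff k ts × value a ts ≡ x ⊖ y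
  far-difference-exists x y = terms , far-diff , represents⇒value≡ {terms} represents
    where
    x+y≤R : x + y ≤ R (x + y)
    x+y≤R = n≤R[n] (x + y)
    window : x + y ∸ suc (suc k) ≤ x + y
    window = m∸n≤m (x + y) (suc (suc k))
    open Representation (representable (x + y) ≤-refl ≤-refl window window
      (≤-trans (m≤m+n x y) (≤-trans x+y≤R (m≤n+m _ y)))
      (≤-trans (m≤n+m y x) (≤-trans x+y≤R (m≤n+m _ x))))

  far-difference-unique : ∀ {ts us} → FarDiff k ts → FarDiff k us → value a ts ≡ value a us → ts ↭ us
  far-difference-unique {ts} {us} ft fu eq =
    ↭-trans (↭-sym (sort-↭ ts)) (subst (_↭ us) (sym sorted-equal) (sort-↭ us))
    where
    sorted-equal : sort ts ≡ sort us
    sorted-equal = descending-unique (sort-↗ ts) (sort-↗ us)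
      (FarDiff-↭ (↭-sym (sort-↭ ts)) ft) (FarDiff-↭ (↭-sym (sort-↭ us)) fu)
      (SameValue-↭ (↭-sym (sort-↭ ts)) (↭-sym (sort-↭ us)) (value≡⇒SameValue {ts} {us} eq))

corollary5p3 : (k : ℕ) → (z : ℤ) →
    (Σ (List Term) (λ ts → FarDiff k ts × value (skip k) ts ≡ z))
    × ((ts us : List Term) → FarDiff k ts → FarDiff k us →
        value (skip k) ts ≡ z → value (skip k) us ≡ z → ts ↭ us)
corollary5p3 k z with ⊖-surjective z
... | x , y , refl =
  far-difference-exists x y , λ _ _ ft fu vt vu → far-difference-unique ft fu (trans vt (sym vu))
  where open Skipponacci k
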